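{- Let $G$ be a finite graph (loopless, multiple edges allowed), let $m$ be a positive integer, and let $F$ be a factor of $G$ and $T$ an $m$-tree-connected factor of $G$. Let $A=\{v\in V(G): d_F(v)\le m\}$, and suppose that $F\setminus E(T)$ is a bipartite graph with bipartition $(A, V(G)\setminus A)$. Let $M$ be a spanning subgraph of $F\setminus E(T)$ such that for each $v\in V(G)\setminus A$, $d_M(v)+d_{F\cap T}(v)\ge m$. Then $G$ has an $m$-tree-connected factor $H$ containing all edges of $F\setminus E(M)$ such that for each vertex $v$, $$d_F(v)\le d_H(v)\le d_T(v)+\max\{0,d_F(v)-m\}.$$
   Context: Graphs have no loops but may have multiple edges. A factor is a spanning subgraph; $d_X(v)$ is the number of edges of $X$ incident to $v$. For a subgraph $X$ and an edge set $E$, $X\setminus E$ is the spanning subgraph with edge set $E(X)\setminus E$. $F\cap T$ is the spanning subgraph whose edges are the edges belonging to both $F$ and $T$. A graph is $m$-tree-connected if it contains $m$ edge-disjoint spanning trees. -}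

module Defs where

open import Data.Nat using (ℕ)
open import Data.Fin using (Fin; _≟_)
open import Data.Fin.Subset using (Subset; _∈_; _∩_; ∣_∣; _⊆_)
open import Data.Vec using (tabulate)
open import Data.Bool using (_∨_)
open import Data.Product using (_×_; _,_; proj₁; proj₂; ∃)
open import Data.Sum using (_⊎_)
open import Data.List using (List; []; _∷_)
open import Data.List.Relation.Unary.Unique.Propositional using (Unique)
open import Relation.Nullary using (¬_)
open import Relation.Nullary.Decidable using (⌊_⌋)
open import Relation.Binary.PropositionalEquality using (_≡_; _≢_)

record Graph : Set where
  field
    n    : ℕ
    k    : ℕ
    ends : Fin k → Fin n × Fin n
    loopless : ∀ e → proj₁ (ends e) ≢ proj₂ (ends e)

open Graph public

Vtx : Graph → Set
Vtx G = Fin (n G)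

-- A factor (spanning subgraph) is given by its edge set.
Factor : Graph → Set
Factor G = Subset (k G)

incident : (G : Graph) → Vtx G → Factor G
incident G v = tabulate (λ e → ⌊ v ≟ proj₁ (ends G e) ⌋ ∨ ⌊ v ≟ proj₂ (ends G e) ⌋)

-- d_X(v): number of edges of X incident with v (no loops, so each counts once)
deg : (G : Graph) → Factor G → Vtx G → ℕ
deg G X v = ∣ X ∩ incident G v ∣

Joins : (G : Graph) → Fin (k G) → Vtx G → Vtx G → Set
Joins G e u w = (proj₁ (ends G e) ≡ u × proj₂ (ends G e) ≡ w)
              ⊎ (proj₁ (ends G e) ≡ w × proj₂ (ends G e) ≡ u)

data Walk (G : Graph) (X : Factor G) : Vtx G → Vtx G → List (Fin (k G)) → Set where
  [] : ∀ {u} → Walk G X u u []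
  step : ∀ {u w v es} (e : Fin (k G)) → e ∈ X → Joins G e u w →
         Walk G X w v es → Walk G X u v (e ∷ es)

Connected : (G : Graph) → Factor G → Set
Connected G X = ∀ (u v : Vtx G) → ∃ λ es → Walk G X u v es

HasCycle : (G : Graph) → Factor G → Set
HasCycle G X = ∃ λ u → ∃ λ e → ∃ λ es → Walk G X u u (e ∷ es) × Unique (e ∷ es)

Acyclic : (G : Graph) → Factor G → Set
Acyclic G X = ¬ HasCycle G X

SpanningTree : (G : Graph) → Factor G → Set
SpanningTree G S = Connected G S × Acyclic G S

TreeConnected : (G : Graph) → ℕ → Factor G → Set
TreeConnected G m X =
  ∃ λ (Tr : Fin m → Factor G) →
    (∀ i → SpanningTree G (Tr i) × Tr i ⊆ X) ×
    (∀ i j → i ≢ j → ∀ e → e ∈ Tr i → ¬ (e ∈ Tr j))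

-- Let A = {v : d_F(v) ≤ m} and N = (F ∖ E(T)) ∖ E(M). Each edge e = ab of F missing from the current
-- m-tree-connected factor H has an end a ∈ A, by the bipartiteness hypothesis. As e ∉ H,
-- d_{F∩H}(a) < d_F(a) ≤ m; but the m edge-disjoint spanning trees of H leave a along m distinct edges
-- (the first edges of their paths to b), so one of them, f, is not in F. Exchanging f for e in its tree
-- keeps H m-tree-connected, keeps F ∩ H, raises no degree in A and shrinks F ∖ H. Absorbing first all
-- of N raises d_H(v), for v ∉ A, by at most d_N(v) ≤ d_F(v) − m; absorbing afterwards edges of F at
-- vertices v ∉ A with d_H(v) < d_F(v) never pushes d_H(v) beyond d_F(v). At v ∈ A, d_F(v) ≤ m ≤ d_H(v)
-- whenever F has an edge at v, because H is m-tree-connected.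
module Submission where

open import Defs
open import Data.Nat using (ℕ; zero; suc; _≤_; _<_; _+_; _∸_; _⊔_; z≤n; s≤s; _≤?_; _<?_)
open import Data.Nat.Properties
  using ( module ≤-Reasoning; ≤-refl; ≤-trans; ≤-<-trans; <-≤-trans; ≤-pred; <⇒≢; <⇒≱; ≮⇒≥; ≰⇒>
        ; +-assoc; +-comm; +-suc; +-identityʳ; +-monoˡ-≤; +-monoʳ-≤; +-cancelʳ-≤; m≤m+n; m<m+n
        ; m≤m⊔n; m≤n⊔m; ⊔-lub; m≤n+m∸n; m+n≤o⇒m≤o∸n )
open import Data.Bool.Properties using (T-∨; T-≡)
open import Data.Fin using (Fin; zero; suc; _≟_)
open import Data.Fin.Properties using (suc-injective; all?; any?; ¬∀⟶∃¬)
open import Data.Fin.Subset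
  using (Subset; inside; outside; _∈_; _∉_; _⊆_; _∩_; _∪_; _─_; _-_; ⁅_⁆; ∣_∣; Empty)
open import Data.Fin.Subset.Properties
  using ( _∈?_; nonempty?; Empty-unique; p⊆q⇒∣p∣≤∣q∣; x∈p⇒∣p-x∣<∣p∣; ∣⁅x⁆∣≡1; ∣⊥∣≡0; ∣p∩q∣≤∣p∣
        ; x∈p∩q⁺; x∈p∩q⁻; x∈p∪q⁺; x∈p∪q⁻; x∈p∧x∉q⇒x∈p─q; x∈p∧x≢y⇒x∈p-y; p─q⊆p
        ; p∩q⊆p; p∩q⊆q; p⊆p∪q; q⊆p∪q; x∈⁅x⁆; x∈⁅y⁆⇒x≡y; x∉⁅y⁆⇒x≢y )
open import Data.Vec using ([]; _∷_; here; there)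
open import Data.Vec.Properties using (lookup∘tabulate; []=⇒lookup; lookup⇒[]=)
open import Data.List using (List; []; _∷_; _++_)
open import Data.List.Membership.Propositional using () renaming (_∈_ to _∈ₗ_; _∉_ to _∉ₗ_)
open import Data.List.Membership.Propositional.Properties using (∈-++⁻)
open import Data.List.Relation.Unary.Any using (here; there)
import Data.List.Relation.Unary.All as All
open import Data.List.Relation.Unary.All.Properties using (++⁻ʳ; ¬Any⇒All¬; All¬⇒¬Any)
open import Data.List.Relation.Unary.AllPairs using ([]; _∷_)
open import Data.List.Relation.Unary.Unique.Propositional using (Unique)
open import Data.Empty using (⊥-elim)
open import Data.Unit using (⊤; tt)
open import Data.Product using (Σ; ∃; _×_; _,_; proj₁; proj₂)
open import Data.Sum using (_⊎_; inj₁; inj₂; [_,_]′)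
import Data.Sum
open import Function using (_∘_; id)
open import Function.Bundles using (Equivalence)
open import Function.Definitions using (Injective)
open import Relation.Binary.PropositionalEquality using (_≡_; _≢_; refl; sym; trans; cong; subst)
open import Relation.Nullary using (¬_; Dec; yes; no; contradiction; ¬?)
open import Relation.Nullary.Decidable using (⌊_⌋; toWitness; fromWitness; _×-dec_)

open ≤-Reasoning

private
  variable
    c : ℕ
    p q r : Subset c
    i j l : Fin c

∣p∪q∣+∣p∩q∣≡∣p∣+∣q∣ : (p q : Subset c) → ∣ p ∪ q ∣ + ∣ p ∩ q ∣ ≡ ∣ p ∣ + ∣ q ∣
∣p∪q∣+∣p∩q∣≡∣p∣+∣q∣ []            []            = refl
∣p∪q∣+∣p∩q∣≡∣p∣+∣q∣ (inside  ∷ p) (inside  ∷ q) =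
  cong suc (trans (+-suc _ _) (trans (cong suc (∣p∪q∣+∣p∩q∣≡∣p∣+∣q∣ p q)) (sym (+-suc _ _))))
∣p∪q∣+∣p∩q∣≡∣p∣+∣q∣ (inside  ∷ p) (outside ∷ q) = cong suc (∣p∪q∣+∣p∩q∣≡∣p∣+∣q∣ p q)
∣p∪q∣+∣p∩q∣≡∣p∣+∣q∣ (outside ∷ p) (inside  ∷ q) =
  trans (cong suc (∣p∪q∣+∣p∩q∣≡∣p∣+∣q∣ p q)) (sym (+-suc _ _))
∣p∪q∣+∣p∩q∣≡∣p∣+∣q∣ (outside ∷ p) (outside ∷ q) = ∣p∪q∣+∣p∩q∣≡∣p∣+∣q∣ p q

∣p∪q∣≤∣p∣+∣q∣ : (p q : Subset c) → ∣ p ∪ q ∣ ≤ ∣ p ∣ + ∣ q ∣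
∣p∪q∣≤∣p∣+∣q∣ p q = subst (∣ p ∪ q ∣ ≤_) (∣p∪q∣+∣p∩q∣≡∣p∣+∣q∣ p q) (m≤m+n _ _)

Empty⇒∣p∣≡0 : Empty p → ∣ p ∣ ≡ 0
Empty⇒∣p∣≡0 {c} e = trans (cong ∣_∣ (Empty-unique e)) (∣⊥∣≡0 c)

disjoint⇒∣p∣+∣q∣≤∣r∣ : Empty (p ∩ q) → p ⊆ r → q ⊆ r → ∣ p ∣ + ∣ q ∣ ≤ ∣ r ∣
disjoint⇒∣p∣+∣q∣≤∣r∣ {p = p} {q} {r} disj p⊆r q⊆r = begin
  ∣ p ∣ + ∣ q ∣             ≡⟨ sym (∣p∪q∣+∣p∩q∣≡∣p∣+∣q∣ p q) ⟩
  ∣ p ∪ q ∣ + ∣ p ∩ q ∣     ≡⟨ cong (∣ p ∪ q ∣ +_) (Empty⇒∣p∣≡0 disj) ⟩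
  ∣ p ∪ q ∣ + 0             ≡⟨ +-identityʳ _ ⟩
  ∣ p ∪ q ∣                 ≤⟨ p⊆q⇒∣p∣≤∣q∣ (λ x∈p∪q → [ p⊆r , q⊆r ]′ (x∈p∪q⁻ p q x∈p∪q)) ⟩
  ∣ r ∣                     ∎

injection⇒m≤∣p∣ : ∀ {m} (g : Fin m → Fin c) → Injective _≡_ _≡_ g → (∀ i → g i ∈ p) → m ≤ ∣ p ∣
injection⇒m≤∣p∣ {m = zero}  g inj g∈p = z≤n
injection⇒m≤∣p∣ {p = p} {m = suc m} g inj g∈p =
  <-≤-trans (s≤s (injection⇒m≤∣p∣ (g ∘ suc) (suc-injective ∘ inj) g∘suc∈p-g0)) (x∈p⇒∣p-x∣<∣p∣ (g∈p zero))
  where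
  g∘suc∈p-g0 : ∀ i → g (suc i) ∈ p - g zero
  g∘suc∈p-g0 i = x∈p∧x≢y⇒x∈p-y (g∈p (suc i)) (λ eq → contradiction (inj eq) λ ())

p⊆q⇒p∩r⊆q∩r : p ⊆ q → p ∩ r ⊆ q ∩ r
p⊆q⇒p∩r⊆q∩r {p = p} {r = r} p⊆q x∈p∩r with x∈p∩q⁻ p r x∈p∩r
... | x∈p , x∈r = x∈p∩q⁺ (p⊆q x∈p , x∈r)

x∈p─q⇒x∉q : i ∈ p ─ q → i ∉ q
x∈p─q⇒x∉q {p = inside  ∷ _} () here
x∈p─q⇒x∉q {p = outside ∷ _} () here
x∈p─q⇒x∉q {p = _ ∷ _} {_ ∷ _} (there x∈) (there x∈q) = x∈p─q⇒x∉q x∈ x∈q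

exchange : Subset c → Fin c → Fin c → Subset c
exchange p i j = (p ∪ ⁅ i ⁆) - j

∈-exchange⁺ : l ∈ p ⊎ l ≡ i → l ≢ j → l ∈ exchange p i j
∈-exchange⁺ {i = i} l∈p∪i l≢j =
  x∈p∧x≢y⇒x∈p-y (x∈p∪q⁺ (Data.Sum.map₂ (λ { refl → x∈⁅x⁆ i }) l∈p∪i)) l≢j

∈-exchange⁻ : l ∈ exchange p i j → (l ∈ p ⊎ l ≡ i) × l ≢ j
∈-exchange⁻ {p = p} {i} l∈ =
  Data.Sum.map₂ (x∈⁅y⁆⇒x≡y i) (x∈p∪q⁻ p ⁅ i ⁆ (p─q⊆p _ _ l∈)) , x∉⁅y⁆⇒x≢y (x∈p─q⇒x∉q l∈)

∩⊆exchange : j ∉ q → q ∩ p ⊆ exchange p i j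
∩⊆exchange {q = q} {p} j∉q l∈ with x∈p∩q⁻ q p l∈
... | l∈q , l∈p = ∈-exchange⁺ (inj₁ l∈p) λ { refl → j∉q l∈q }

exchange∋ : i ∉ p → j ∈ p → i ∈ exchange p i j
exchange∋ i∉p j∈p = ∈-exchange⁺ (inj₂ refl) λ { refl → i∉p j∈p }

∣q─exchange∣<∣q─p∣ : i ∈ q → i ∉ p → j ∈ p → j ∉ q → ∣ q ─ exchange p i j ∣ < ∣ q ─ p ∣
∣q─exchange∣<∣q─p∣ {i = i} {q} {p} {j} i∈q i∉p j∈p j∉q =
  ≤-<-trans (p⊆q⇒∣p∣≤∣q∣ ⊆q─p-i) (x∈p⇒∣p-x∣<∣p∣ (x∈p∧x∉q⇒x∈p─q i∈q i∉p))
  where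
  ⊆q─p-i : q ─ exchange p i j ⊆ (q ─ p) - i
  ⊆q─p-i l∈ = x∈p∧x≢y⇒x∈p-y (x∈p∧x∉q⇒x∈p─q l∈q λ l∈p → l∉ (∩⊆exchange j∉q (x∈p∩q⁺ (l∈q , l∈p))))
                            λ { refl → l∉ (exchange∋ i∉p j∈p) }
    where
    l∈q = p─q⊆p q _ l∈
    l∉ = x∈p─q⇒x∉q l∈

Empty[p─q]⇒p⊆q : Empty (p ─ q) → p ⊆ q
Empty[p─q]⇒p⊆q {q = q} empty {i} i∈p with i ∈? q
... | yes i∈q = i∈q
... | no  i∉q = ⊥-elim (empty (i , x∈p∧x∉q⇒x∈p─q i∈p i∉q))

descent : {A : Set} (μ : A → ℕ) (P Q : A → Set) →
          (∀ x → P x → Q x ⊎ ∃ λ y → P y × μ y < μ x) → ∀ x → P x → ∃ λ y → P y × Q y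
descent μ P Q progress x Px = go (suc (μ x)) x ≤-refl Px
  where
  go : ∀ n x → μ x < n → P x → ∃ λ y → P y × Q y
  go (suc n) x μx<1+n Px with progress x Px
  ... | inj₁ Qx                = x , Px , Qx
  ... | inj₂ (y , Py , μy<μx) = go n y (<-≤-trans μy<μx (≤-pred μx<1+n)) Py

unique-middle : ∀ {A : Set} (xs : List A) {x ys} → Unique (xs ++ x ∷ ys) → x ∉ₗ xs × x ∉ₗ ys
unique-middle []       (x∉ys ∷ _) = (λ ()) , All¬⇒¬Any x∉ys
unique-middle (y ∷ xs) {x} (y∉rest ∷ u) = x∉y∷xs , proj₂ (unique-middle xs u)
  where
  x∉y∷xs : x ∉ₗ y ∷ xs
  x∉y∷xs (here x≡y)  = All.head (++⁻ʳ xs y∉rest) (sym x≡y)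
  x∉y∷xs (there x∈xs) = proj₁ (unique-middle xs u) x∈xs

module OnGraph (G : Graph) where

  private
    variable
      m : ℕ
      S T X Y Z : Factor G
      e g : Fin (k G)
      a b u v w x y z : Vtx G
      es fs : List (Fin (k G))

  incident⇒endpoint : e ∈ incident G v → proj₁ (ends G e) ≡ v ⊎ proj₂ (ends G e) ≡ v
  incident⇒endpoint {e} {v} e∈ =
    Data.Sum.map (sym ∘ toWitness) (sym ∘ toWitness)
      (Equivalence.to (T-∨ {⌊ v ≟ proj₁ (ends G e) ⌋})
        (Equivalence.from T-≡ (trans (sym (lookup∘tabulate _ e)) ([]=⇒lookup e∈))))

  endpoint⇒incident : proj₁ (ends G e) ≡ v ⊎ proj₂ (ends G e) ≡ v → e ∈ incident G v
  endpoint⇒incident {e} {v} h =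
    lookup⇒[]= e _ (trans (lookup∘tabulate _ e)
      (Equivalence.to T-≡ (Equivalence.from (T-∨ {⌊ v ≟ proj₁ (ends G e) ⌋})
        (Data.Sum.map (fromWitness ∘ sym) (fromWitness ∘ sym) h))))

  joins-sym : Joins G e u w → Joins G e w u
  joins-sym = Data.Sum.swap

  joins⇒≢ : Joins G e u w → u ≢ w
  joins⇒≢ {e} (inj₁ (p , q)) refl = loopless G e (trans p (sym q))
  joins⇒≢ {e} (inj₂ (p , q)) refl = loopless G e (trans p (sym q))

  joins⇒incident : Joins G e u w → e ∈ incident G u
  joins⇒incident (inj₁ (p , _)) = endpoint⇒incident (inj₁ p)
  joins⇒incident (inj₂ (_ , q)) = endpoint⇒incident (inj₂ q)

  incident⇒joins : e ∈ incident G v → ∃ λ w → Joins G e v w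
  incident⇒joins {v = v} e∈ with incident⇒endpoint {v = v} e∈
  ... | inj₁ p = _ , inj₁ (p , refl)
  ... | inj₂ q = _ , inj₂ (refl , q)

  joins-incident⇒endpoint : Joins G e u w → e ∈ incident G v → v ≡ u ⊎ v ≡ w
  joins-incident⇒endpoint {v = v} j e∈ with j | incident⇒endpoint {v = v} e∈
  ... | inj₁ (p , q) | inj₁ r = inj₁ (trans (sym r) p)
  ... | inj₁ (p , q) | inj₂ r = inj₂ (trans (sym r) q)
  ... | inj₂ (p , q) | inj₁ r = inj₂ (trans (sym r) p)
  ... | inj₂ (p , q) | inj₂ r = inj₁ (trans (sym r) q)

  joins-unique : ∀ {y z} → Joins G e u w → Joins G e y z → (y ≡ u × z ≡ w) ⊎ (y ≡ w × z ≡ u)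
  joins-unique (inj₁ (p , q)) (inj₁ (p′ , q′)) = inj₁ (trans (sym p′) p , trans (sym q′) q)
  joins-unique (inj₁ (p , q)) (inj₂ (p′ , q′)) = inj₂ (trans (sym q′) q , trans (sym p′) p)
  joins-unique (inj₂ (p , q)) (inj₁ (p′ , q′)) = inj₂ (trans (sym p′) p , trans (sym q′) q)
  joins-unique (inj₂ (p , q)) (inj₂ (p′ , q′)) = inj₁ (trans (sym q′) q , trans (sym p′) p)

  deg-mono : X ⊆ Y → deg G X v ≤ deg G Y v
  deg-mono X⊆Y = p⊆q⇒∣p∣≤∣q∣ (p⊆q⇒p∩r⊆q∩r X⊆Y)

  deg-∪ : deg G (X ∪ Y) v ≤ deg G X v + deg G Y v
  deg-∪ {X} {Y} {v} = ≤-trans (p⊆q⇒∣p∣≤∣q∣ split) (∣p∪q∣≤∣p∣+∣q∣ (X ∩ incident G v) (Y ∩ incident G v))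
    where
    split : (X ∪ Y) ∩ incident G v ⊆ (X ∩ incident G v) ∪ (Y ∩ incident G v)
    split x∈ with x∈p∩q⁻ (X ∪ Y) _ x∈
    ... | x∈X∪Y , x∈I = x∈p∪q⁺ (Data.Sum.map (λ x∈X → x∈p∩q⁺ (x∈X , x∈I)) (λ x∈Y → x∈p∩q⁺ (x∈Y , x∈I))
                                              (x∈p∪q⁻ X Y x∈X∪Y))

  deg-disjoint : Empty (X ∩ Y) → X ⊆ Z → Y ⊆ Z → deg G X v + deg G Y v ≤ deg G Z v
  deg-disjoint {X} {Y} {Z} {v} disj X⊆Z Y⊆Z =
    disjoint⇒∣p∣+∣q∣≤∣r∣ disj′ (p⊆q⇒p∩r⊆q∩r X⊆Z) (p⊆q⇒p∩r⊆q∩r Y⊆Z)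
    where
    disj′ : Empty ((X ∩ incident G v) ∩ (Y ∩ incident G v))
    disj′ (x , x∈) with x∈p∩q⁻ (X ∩ incident G v) _ x∈
    ... | x∈XI , x∈YI = disj (x , x∈p∩q⁺ (proj₁ (x∈p∩q⁻ X _ x∈XI) , proj₁ (x∈p∩q⁻ Y _ x∈YI)))

  deg-⁅⁆≤1 : deg G ⁅ e ⁆ v ≤ 1
  deg-⁅⁆≤1 {e} {v} = subst (deg G ⁅ e ⁆ v ≤_) (∣⁅x⁆∣≡1 e) (∣p∩q∣≤∣p∣ ⁅ e ⁆ (incident G v))

  incident⇒1≤deg-⁅⁆ : e ∈ incident G v → 1 ≤ deg G ⁅ e ⁆ v
  incident⇒1≤deg-⁅⁆ {e} {v} e∈ = subst (_≤ deg G ⁅ e ⁆ v) (∣⁅x⁆∣≡1 e) (p⊆q⇒∣p∣≤∣q∣ λ x∈⁅e⁆ →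
    x∈p∩q⁺ (x∈⁅e⁆ , subst (_∈ incident G v) (sym (x∈⁅y⁆⇒x≡y e x∈⁅e⁆)) e∈))

  ¬incident⇒deg-⁅⁆≡0 : e ∉ incident G v → deg G ⁅ e ⁆ v ≡ 0
  ¬incident⇒deg-⁅⁆≡0 {e} {v} e∉ = Empty⇒∣p∣≡0 λ (x , x∈) →
    let x∈⁅e⁆ , x∈I = x∈p∩q⁻ ⁅ e ⁆ (incident G v) x∈ in e∉ (subst (_∈ incident G v) (x∈⁅y⁆⇒x≡y e x∈⁅e⁆) x∈I)

  0<deg⇒incident : 0 < deg G X v → ∃ λ e → e ∈ incident G v
  0<deg⇒incident {X} {v} 0<deg with nonempty? (X ∩ incident G v)
  ... | yes (e , e∈) = e , proj₂ (x∈p∩q⁻ X _ e∈)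
  ... | no empty = contradiction (Empty⇒∣p∣≡0 empty) (λ deg≡0 → <⇒≢ 0<deg (sym deg≡0))

  deg<deg⇒edge : deg G T v < deg G X v → ∃ λ e → e ∈ X × e ∉ T × e ∈ incident G v
  deg<deg⇒edge {T} {v} {X} deg<deg with nonempty? ((X ∩ incident G v) ─ T)
  ... | yes (e , e∈) = let e∈X , e∋v = x∈p∩q⁻ X _ (p─q⊆p _ T e∈) in e , e∈X , x∈p─q⇒x∉q e∈ , e∋v
  ... | no  empty = ⊥-elim (<⇒≱ deg<deg (p⊆q⇒∣p∣≤∣q∣ λ g∈ →
                      x∈p∩q⁺ (Empty[p─q]⇒p⊆q empty g∈ , proj₂ (x∈p∩q⁻ X _ g∈))))

  deg+deg-⁅⁆≤ : e ∉ X → X ⊆ Z → e ∈ Z → deg G X v + deg G ⁅ e ⁆ v ≤ deg G Z v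
  deg+deg-⁅⁆≤ {e} {X} {Z} {v} e∉X X⊆Z e∈Z = deg-disjoint {v = v} disjoint X⊆Z ⁅e⁆⊆Z
    where
    disjoint : Empty (X ∩ ⁅ e ⁆)
    disjoint (g , g∈) with x∈p∩q⁻ X ⁅ e ⁆ g∈
    ... | g∈X , g∈⁅e⁆ = e∉X (subst (_∈ X) (x∈⁅y⁆⇒x≡y e g∈⁅e⁆) g∈X)
    ⁅e⁆⊆Z : ⁅ e ⁆ ⊆ Z
    ⁅e⁆⊆Z g∈⁅e⁆ = subst (_∈ Z) (sym (x∈⁅y⁆⇒x≡y e g∈⁅e⁆)) e∈Z

  deg-∩<deg : e ∈ X → e ∉ T → e ∈ incident G v → deg G (X ∩ T) v < deg G X v
  deg-∩<deg {e} {X} {T} {v} e∈X e∉T e∋v = <-≤-trans (m<m+n _ (incident⇒1≤deg-⁅⁆ {v = v} e∋v))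
    (deg+deg-⁅⁆≤ {v = v} (e∉T ∘ proj₂ ∘ x∈p∩q⁻ X T) (p∩q⊆p X T) e∈X)

  deg-exchange≤ : ∀ T e g v → deg G (exchange T e g) v ≤ deg G T v + deg G ⁅ e ⁆ v
  deg-exchange≤ T e g v = ≤-trans (deg-mono {v = v} (p─q⊆p (T ∪ ⁅ e ⁆) ⁅ g ⁆)) (deg-∪ {X = T} {⁅ e ⁆} {v})

  deg-exchange≤deg : g ∈ T → (e ∈ incident G v → g ∈ incident G v) → deg G (exchange T e g) v ≤ deg G T v
  deg-exchange≤deg {g} {T} {e} {v} g∈T e∋v⇒g∋v = +-cancelʳ-≤ (deg G ⁅ g ⁆ v) _ _ (begin
    deg G (exchange T e g) v + deg G ⁅ g ⁆ v  ≤⟨ deg+deg-⁅⁆≤ {v = v} g∉T′ (p─q⊆p _ _) (x∈p∪q⁺ (inj₁ g∈T)) ⟩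
    deg G (T ∪ ⁅ e ⁆) v                       ≤⟨ deg-∪ {X = T} {⁅ e ⁆} {v} ⟩
    deg G T v + deg G ⁅ e ⁆ v                 ≤⟨ +-monoʳ-≤ (deg G T v) deg-⁅e⁆≤deg-⁅g⁆ ⟩
    deg G T v + deg G ⁅ g ⁆ v                 ∎)
    where
    g∉T′ : g ∉ exchange T e g
    g∉T′ g∈ = proj₂ (∈-exchange⁻ g∈) refl
    deg-⁅e⁆≤deg-⁅g⁆ : deg G ⁅ e ⁆ v ≤ deg G ⁅ g ⁆ v
    deg-⁅e⁆≤deg-⁅g⁆ with e ∈? incident G v
    ... | yes e∋v = ≤-trans (deg-⁅⁆≤1 {e = e} {v}) (incident⇒1≤deg-⁅⁆ {v = v} (e∋v⇒g∋v e∋v))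
    ... | no  e∌v = subst (_≤ deg G ⁅ g ⁆ v) (sym (¬incident⇒deg-⁅⁆≡0 {v = v} e∌v)) z≤n

  open import Data.List.Membership.DecPropositional (_≟_ {n G}) using () renaming (_∈?_ to _∈ᵛ?_)
  open import Data.List.Membership.DecPropositional (_≟_ {k G}) using () renaming (_∈?_ to _∈ᵉ?_)

  WalkBetween : Factor G → Vtx G → Vtx G → Set
  WalkBetween X u v = ∃ (Walk G X u v)

  _++ᵂ_ : Walk G X u v es → Walk G X v w fs → Walk G X u w (es ++ fs)
  []             ++ᵂ W = W
  step e e∈ j W₁ ++ᵂ W = step e e∈ j (W₁ ++ᵂ W)

  reverseᵂ : Walk G X u v es → WalkBetween X v u
  reverseᵂ []             = _ , []
  reverseᵂ (step e e∈ j W) = _ , (proj₂ (reverseᵂ W) ++ᵂ step e e∈ (joins-sym {e = e} j) [])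

  walk-edge∈ : Walk G X u v es → g ∈ₗ es → g ∈ X
  walk-edge∈ (step e e∈ j W) (here refl) = e∈
  walk-edge∈ (step e e∈ j W) (there g∈)  = walk-edge∈ W g∈

  transfer : Walk G X u v es → (∀ {g} → g ∈ₗ es → g ∈ X → g ∈ Y) → Walk G Y u v es
  transfer []              h = []
  transfer (step e e∈ j W) h = step e (h (here refl) e∈) j (transfer W (h ∘ there))

  substitute : (∀ {g y z} → g ∈ X → Joins G g y z → WalkBetween Y y z) → Walk G X u v es → WalkBetween Y u v
  substitute h []              = _ , []
  substitute h (step e e∈ j W) = _ , (proj₂ (h e∈ j) ++ᵂ proj₂ (substitute h W))

  vertices : Walk G X u v es → List (Vtx G)
  vertices {u = u} []             = u ∷ []
  vertices {u = u} (step _ _ _ W) = u ∷ vertices W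

  start∈vertices : (W : Walk G X u v es) → u ∈ₗ vertices W
  start∈vertices []             = here refl
  start∈vertices (step _ _ _ _) = here refl

  endpoint∈vertices : (W : Walk G X u v es) → g ∈ₗ es → Joins G g y z → y ∈ₗ vertices W
  endpoint∈vertices (step e _ j W) (here refl) j′ with joins-unique {e = e} j j′
  ... | inj₁ (refl , _) = here refl
  ... | inj₂ (refl , _) = there (start∈vertices W)
  endpoint∈vertices (step e _ j W) (there g∈) j′ = there (endpoint∈vertices W g∈ j′)

  Simple : Walk G X u v es → Set
  Simple []                      = ⊤
  Simple {u = u} (step _ _ _ W) = u ∉ₗ vertices W × Simple W

  simple-suffix : (W : Walk G X w v es) → Simple W → u ∈ₗ vertices W →
                  ∃ λ fs → Σ (Walk G X u v fs) Simple
  simple-suffix []              s       (here refl) = _ , [] , tt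
  simple-suffix (step e e∈ j W) s       (here refl) = _ , step e e∈ j W , s
  simple-suffix (step e e∈ j W) (_ , s) (there u∈)  = simple-suffix W s u∈

  shortcut : Walk G X u v es → ∃ λ fs → Σ (Walk G X u v fs) Simple
  shortcut []                          = _ , [] , tt
  shortcut {u = u} (step e e∈ j W) with shortcut W
  ... | _ , W′ , s with u ∈ᵛ? vertices W′
  ...   | yes u∈ = simple-suffix W′ s u∈
  ...   | no  u∉ = _ , step e e∈ j W′ , u∉ , s

  simple⇒unique : (W : Walk G X u v es) → Simple W → Unique es
  simple⇒unique []               tt       = []
  simple⇒unique (step e _ j W) (u∉ , s) = ¬Any⇒All¬ _ (λ e∈ → u∉ (endpoint∈vertices W e∈ j)) ∷ simple⇒unique W s

  record Departure (X : Factor G) (a b : Vtx G) : Set where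
    field
      edge   : Fin (k G)
      edge∈  : edge ∈ X
      far    : Vtx G
      joins  : Joins G edge a far
      trail  : List (Fin (k G))
      rest   : Walk G X far b trail
      avoids : a ∉ₗ vertices rest

  lastDeparture : (W : Walk G X u b es) → a ∈ₗ vertices W → a ≢ b → Departure X a b
  lastDeparture []              (here refl) a≢b = contradiction refl a≢b
  lastDeparture {a = a} (step e e∈ j W) a∈ a≢b with a ∈ᵛ? vertices W | a∈
  ... | yes a∈W | _          = lastDeparture W a∈W a≢b
  ... | no  a∉W | here refl  = record { edge∈ = e∈ ; joins = j ; rest = W ; avoids = a∉W }
  ... | no  a∉W | there a∈W = contradiction a∈W a∉W

  departure : Connected G X → a ≢ b → Departure X a b
  departure conn a≢b = lastDeparture (proj₂ (conn _ _)) (start∈vertices _) a≢b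

  splitAt : Walk G X u v es → e ∈ₗ es →
    ∃ λ y → ∃ λ z → ∃ λ es₁ → ∃ λ es₂ →
      Walk G X u y es₁ × Joins G e y z × Walk G X z v es₂ × es ≡ es₁ ++ e ∷ es₂
  splitAt (step e e∈ j W) (here refl) = _ , _ , [] , _ , [] , j , W , refl
  splitAt (step e e∈ j W) (there e′∈) with splitAt W e′∈
  ... | y , z , es₁ , es₂ , P , j′ , Q , refl = y , z , e ∷ es₁ , es₂ , step e e∈ j P , j′ , Q , refl

  cycle-detour : Walk G X u u es → Unique es → e ∈ₗ es →
    ∃ λ y → ∃ λ z → Joins G e y z × ∃ λ fs → Walk G X z y fs × e ∉ₗ fs
  cycle-detour C U e∈ with splitAt C e∈
  ... | y , z , es₁ , es₂ , P , j , Q , refl =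
    y , z , j , _ , Q ++ᵂ P , [ proj₂ e∉ , proj₁ e∉ ]′ ∘ ∈-++⁻ es₂
    where e∉ = unique-middle es₁ U

  -- A cycle of the new factor must use e; the rest of it, `rest` and f then form a cycle of S.
  spanningTree-exchange : SpanningTree G S → e ∉ S → Joins G e a b → (d : Departure S a b) →
                          SpanningTree G (exchange S e (Departure.edge d))
  spanningTree-exchange {S} {e} {a} {b} (conn , acyc) e∉S je d = connected , acyclic
    where
    open Departure d renaming (edge to f; edge∈ to f∈S)
    S′ = exchange S e f

    e∈S′ : e ∈ S′
    e∈S′ = ∈-exchange⁺ (inj₂ refl) λ { refl → e∉S f∈S }

    ∈S′⇒∈S : g ∈ S′ → g ≢ e → g ∈ S
    ∈S′⇒∈S g∈S′ g≢e = [ id , ⊥-elim ∘ g≢e ]′ (proj₁ (∈-exchange⁻ g∈S′))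

    ∈S′⇒∈S-f : g ∈ S′ → g ≢ e → g ∈ S - f
    ∈S′⇒∈S-f g∈S′ g≢e = x∈p∧x≢y⇒x∈p-y (∈S′⇒∈S g∈S′ g≢e) (proj₂ (∈-exchange⁻ g∈S′))

    trail∌f : g ∈ₗ trail → g ≢ f
    trail∌f g∈ refl = avoids (endpoint∈vertices rest g∈ joins)

    rest′ : Walk G S′ far b trail
    rest′ = transfer rest λ g∈ g∈S → ∈-exchange⁺ (inj₁ g∈S) (trail∌f g∈)

    rest-avoiding-f : Walk G (S - f) far b trail
    rest-avoiding-f = transfer rest λ g∈ g∈S → x∈p∧x≢y⇒x∈p-y g∈S (trail∌f g∈)

    reroute : g ∈ S → Joins G g y z → WalkBetween S′ y z
    reroute {g} g∈S j with g ≟ f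
    ... | no g≢f = _ , step g (∈-exchange⁺ (inj₁ g∈S) g≢f) j []
    ... | yes refl with joins-unique {e = f} joins j
    ...   | inj₁ (refl , refl) = _ , step e e∈S′ je (proj₂ (reverseᵂ rest′))
    ...   | inj₂ (refl , refl) = _ , (rest′ ++ᵂ step e e∈S′ (joins-sym {e = e} je) [])

    connected : Connected G S′
    connected u v = substitute reroute (proj₂ (conn u v))

    b⇝a-avoiding-f : Walk G S′ u u es → Unique es → e ∈ₗ es → WalkBetween (S - f) b a
    b⇝a-avoiding-f C U e∈ with cycle-detour C U e∈
    ... | y , z , j , fs , Q , e∉fs =
      orient (joins-unique {e = e} je j) (transfer Q λ g∈ g∈S′ → ∈S′⇒∈S-f g∈S′ λ { refl → e∉fs g∈ })
      where
      orient : (y ≡ a × z ≡ b) ⊎ (y ≡ b × z ≡ a) → Walk G (S - f) z y fs → WalkBetween (S - f) b a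
      orient (inj₁ (refl , refl)) Q′ = _ , Q′
      orient (inj₂ (refl , refl)) Q′ = reverseᵂ Q′

    acyclic : Acyclic G S′
    acyclic (u , e₀ , es , C , U) with e ∈ᵉ? (e₀ ∷ es)
    ... | no e∉C = acyc (u , e₀ , es , transfer C (λ g∈ g∈S′ → ∈S′⇒∈S g∈S′ λ { refl → e∉C g∈ }) , U)
    ... | yes e∈C with shortcut (rest-avoiding-f ++ᵂ proj₂ (b⇝a-avoiding-f C U e∈C))
    ...   | fs , W , simple =
      acyc (a , f , fs , step f f∈S joins (transfer W λ _ → p─q⊆p S ⁅ f ⁆) ,
            All.tabulate (λ g∈ f≡g → x∉⁅y⁆⇒x≢y (x∈p─q⇒x∉q (walk-edge∈ W g∈)) (sym f≡g)) ∷ simple⇒unique W simple)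

  treeDeparture : (tc : TreeConnected G m T) → a ≢ b → (i : Fin m) → Departure (proj₁ tc i) a b
  treeDeparture (_ , trees , _) a≢b i = departure (proj₁ (proj₁ (trees i))) a≢b

  departureEdge : TreeConnected G m T → a ≢ b → Fin m → Fin (k G)
  departureEdge tc a≢b i = Departure.edge (treeDeparture tc a≢b i)

  departureEdge∈ : (tc : TreeConnected G m T) (a≢b : a ≢ b) (i : Fin m) → departureEdge tc a≢b i ∈ T
  departureEdge∈ tc@(_ , trees , _) a≢b i = proj₂ (trees i) (Departure.edge∈ (treeDeparture tc a≢b i))

  departureEdge-injective : (tc : TreeConnected G m T) (a≢b : a ≢ b) → Injective _≡_ _≡_ (departureEdge tc a≢b)
  departureEdge-injective tc@(Tr , _ , disjoint) a≢b {i} {j} eq with i ≟ j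
  ... | yes i≡j = i≡j
  ... | no  i≢j = ⊥-elim (disjoint i j i≢j _ (edge∈ i) (subst (_∈ Tr j) (sym eq) (edge∈ j)))
    where edge∈ = λ i → Departure.edge∈ (treeDeparture tc a≢b i)

  departureEdges⊆⇒m≤deg : (tc : TreeConnected G m T) (a≢b : a ≢ b) →
                          (∀ i → departureEdge tc a≢b i ∈ X) → m ≤ deg G X a
  departureEdges⊆⇒m≤deg tc a≢b ⊆X = injection⇒m≤∣p∣ (departureEdge tc a≢b) (departureEdge-injective tc a≢b)
    λ i → x∈p∩q⁺ (⊆X i , joins⇒incident (Departure.joins (treeDeparture tc a≢b i)))

  treeConnected⇒m≤deg : TreeConnected G m T → e ∈ incident G v → m ≤ deg G T v
  treeConnected⇒m≤deg {v = v} tc e∈ =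
    departureEdges⊆⇒m≤deg tc a≢b (departureEdge∈ tc a≢b)
    where a≢b = joins⇒≢ (proj₂ (incident⇒joins {v = v} e∈))

  treeConnected-exchangeAt : (tc : TreeConnected G m T) → e ∉ T → (je : Joins G e a b) (i : Fin m) →
                             TreeConnected G m (exchange T e (departureEdge tc (joins⇒≢ {e = e} je) i))
  treeConnected-exchangeAt {m} {T} {e} tc@(Tr , trees , disjoint) e∉T je i = Tr′ , trees′ , disjoint′
    where
    d = treeDeparture tc (joins⇒≢ {e = e} je) i
    open Departure d using () renaming (edge to f; edge∈ to f∈Trᵢ)

    Tr′ : Fin m → Factor G
    Tr′ j with j ≟ i
    ... | yes _ = exchange (Tr i) e f
    ... | no  _ = Tr j

    ∉Trⱼ : ∀ {j} → j ≢ i → g ∈ Tr j → g ≢ f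
    ∉Trⱼ j≢i g∈ refl = disjoint _ i j≢i _ g∈ f∈Trᵢ

    ∈Tr′ᵢ⇒∈Trᵢ : g ∈ exchange (Tr i) e f → g ∈ T → g ∈ Tr i
    ∈Tr′ᵢ⇒∈Trᵢ g∈ g∈T = [ id , (λ { refl → ⊥-elim (e∉T g∈T) }) ]′ (proj₁ (∈-exchange⁻ g∈))

    trees′ : ∀ j → SpanningTree G (Tr′ j) × Tr′ j ⊆ exchange T e f
    trees′ j with j ≟ i
    ... | yes refl = spanningTree-exchange (proj₁ (trees i)) (e∉T ∘ proj₂ (trees i)) je d , λ g∈ →
                       let g∈Trᵢ⊎g≡e , g≢f = ∈-exchange⁻ g∈
                       in ∈-exchange⁺ (Data.Sum.map₁ (proj₂ (trees i)) g∈Trᵢ⊎g≡e) g≢f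
    ... | no  j≢i = proj₁ (trees j) , λ g∈ → ∈-exchange⁺ (inj₁ (proj₂ (trees j) g∈)) (∉Trⱼ j≢i g∈)

    disjoint′ : ∀ j j′ → j ≢ j′ → ∀ g → g ∈ Tr′ j → ¬ (g ∈ Tr′ j′)
    disjoint′ j j′ j≢j′ g g∈ g∈′ with j ≟ i | j′ ≟ i
    ... | yes refl | yes refl = j≢j′ refl
    ... | yes refl | no  _    = disjoint i j′ j≢j′ g (∈Tr′ᵢ⇒∈Trᵢ g∈ (proj₂ (trees j′) g∈′)) g∈′
    ... | no  _    | yes refl = disjoint j i j≢j′ g g∈ (∈Tr′ᵢ⇒∈Trᵢ g∈′ (proj₂ (trees j) g∈))
    ... | no  _    | no  _    = disjoint j j′ j≢j′ g g∈ g∈′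

  -- The departure edges at a of the m trees are distinct edges of T at a, so they cannot all lie in X.
  treeConnected-exchange : TreeConnected G m T → e ∉ T → Joins G e a b → deg G (X ∩ T) a < m →
    ∃ λ f → f ∈ T × f ∉ X × f ∈ incident G a × TreeConnected G m (exchange T e f)
  treeConnected-exchange {m} {T} {e} {a} {b} {X} tc e∉T je deg<m = choose (all? λ i → departing i ∈? X)
    where
    a≢b = joins⇒≢ {e = e} je
    departing = departureEdge tc a≢b
    choose : Dec (∀ i → departing i ∈ X) →
             ∃ λ f → f ∈ T × f ∉ X × f ∈ incident G a × TreeConnected G m (exchange T e f)
    choose (yes all∈X) =
      ⊥-elim (<⇒≱ deg<m (departureEdges⊆⇒m≤deg tc a≢b λ i → x∈p∩q⁺ (all∈X i , departureEdge∈ tc a≢b i)))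
    choose (no ¬all∈X) with ¬∀⟶∃¬ m _ (λ i → departing i ∈? X) ¬all∈X
    ... | i , f∉X = departing i , departureEdge∈ tc a≢b i , f∉X ,
                    joins⇒incident (Departure.joins (treeDeparture tc a≢b i)) , treeConnected-exchangeAt tc e∉T je i

module Construction (G : Graph) (m : ℕ) (F T₀ M : Factor G) (tc₀ : TreeConnected G m T₀)
  (bipartite : ∀ e → e ∈ (F ─ T₀) →
      (deg G F (proj₁ (ends G e)) ≤ m × ¬ (deg G F (proj₂ (ends G e)) ≤ m))
    ⊎ (¬ (deg G F (proj₁ (ends G e)) ≤ m) × deg G F (proj₂ (ends G e)) ≤ m))
  (M⊆F─T₀ : M ⊆ F ─ T₀) where

  open OnGraph G

  private
    variable
      T H : Factor G
      e : Fin (k G)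
      v w : Vtx G

  InA : Vtx G → Set
  InA v = deg G F v ≤ m

  N : Factor G
  N = (F ─ T₀) ─ M

  N⊆F : N ⊆ F
  N⊆F = p─q⊆p F T₀ ∘ p─q⊆p (F ─ T₀) M

  bipartite-ends : e ∈ F ─ T₀ → ∃ λ a → ∃ λ b → Joins G e a b × InA a × ¬ InA b
  bipartite-ends {e} e∈ with bipartite e e∈
  ... | inj₁ (a∈A , b∉A) = _ , _ , inj₁ (refl , refl) , a∈A , b∉A
  ... | inj₂ (b∉A , a∈A) = _ , _ , inj₂ (refl , refl) , a∈A , b∉A

  outer-end-unique : e ∈ F ─ T₀ → e ∈ incident G v → e ∈ incident G w → ¬ InA v → ¬ InA w → v ≡ w
  outer-end-unique {e} {v} {w} e∈ e∋v e∋w v∉A w∉A with bipartite-ends e∈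
  ... | a , b , je , a∈A , _ = trans (outer v e∋v v∉A) (sym (outer w e∋w w∉A))
    where
    outer : ∀ u → e ∈ incident G u → ¬ InA u → u ≡ b
    outer u e∋u u∉A = [ (λ { refl → ⊥-elim (u∉A a∈A) }) , id ]′ (joins-incident⇒endpoint {v = u} je e∋u)

  record Admissible (T : Factor G) : Set where
    field
      treeConnected : TreeConnected G m T
      keeps-F∩T₀    : F ∩ T₀ ⊆ T
      deg-A         : ∀ v → InA v → deg G T v ≤ deg G T₀ v

  open Admissible

  admissible₀ : Admissible T₀
  admissible₀ = record { treeConnected = tc₀ ; keeps-F∩T₀ = p∩q⊆q F T₀ ; deg-A = λ _ _ → ≤-refl }

  ∉Admissible⇒∈F─T₀ : Admissible T → e ∈ F → e ∉ T → e ∈ F ─ T₀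
  ∉Admissible⇒∈F─T₀ adm e∈F e∉T = x∈p∧x∉q⇒x∈p─q e∈F λ e∈T₀ → e∉T (keeps-F∩T₀ adm (x∈p∩q⁺ (e∈F , e∈T₀)))

  record Improvement (T : Factor G) (e : Fin (k G)) : Set where
    field
      next       : Factor G
      admissible : Admissible next
      keeps      : F ∩ T ⊆ next
      adds       : e ∈ next
      shrinks    : ∣ F ─ next ∣ < ∣ F ─ T ∣
      deg-next   : ∀ v → deg G next v ≤ deg G T v + deg G ⁅ e ⁆ v

  improve : Admissible T → e ∈ F → e ∉ T → Improvement T e
  improve {T} {e} adm e∈F e∉T with bipartite-ends (∉Admissible⇒∈F─T₀ adm e∈F e∉T)
  ... | a , b , je , a∈A , b∉A with treeConnected-exchange {X = F} (treeConnected adm) e∉T je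
                                      (<-≤-trans (deg-∩<deg {v = a} e∈F e∉T (joins⇒incident je)) a∈A)
  ...   | f , f∈T , f∉F , f∋a , tc′ = record
    { next       = exchange T e f
    ; admissible = record
      { treeConnected = tc′
      ; keeps-F∩T₀    = λ g∈ → ∩⊆exchange f∉F (x∈p∩q⁺ (proj₁ (x∈p∩q⁻ F T₀ g∈) , keeps-F∩T₀ adm g∈))
      ; deg-A         = λ v v∈A → ≤-trans (deg-exchange≤deg {v = v} f∈T (e∋v⇒f∋v v v∈A)) (deg-A adm v v∈A)
      }
    ; keeps      = ∩⊆exchange f∉F
    ; adds       = exchange∋ e∉T f∈T
    ; shrinks    = ∣q─exchange∣<∣q─p∣ e∈F e∉T f∈T f∉F
    ; deg-next   = deg-exchange≤ T e f
    }
    where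
    e∋v⇒f∋v : ∀ v → InA v → e ∈ incident G v → f ∈ incident G v
    e∋v⇒f∋v v v∈A e∋v with joins-incident⇒endpoint {v = v} je e∋v
    ... | inj₁ refl = f∋a
    ... | inj₂ refl = ⊥-elim (b∉A v∈A)

  Invariant₁ : Factor G → Set
  Invariant₁ T = Admissible T × (∀ v → ¬ InA v → deg G T v ≤ deg G T₀ v + deg G (N ∩ T) v)

  absorb-N : ∀ T → Invariant₁ T → N ⊆ T ⊎ ∃ λ T′ → Invariant₁ T′ × ∣ F ─ T′ ∣ < ∣ F ─ T ∣
  absorb-N T (adm , bound) with nonempty? (N ─ T)
  ... | no  N─T=∅        = inj₁ (Empty[p─q]⇒p⊆q N─T=∅)
  ... | yes (e , e∈N─T) = inj₂ (next , (admissible , bound′) , shrinks)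
    where
    e∈N = p─q⊆p N T e∈N─T
    e∉T = x∈p─q⇒x∉q e∈N─T
    open Improvement (improve adm (N⊆F e∈N) e∉T)
    N∩T⊆N∩next : N ∩ T ⊆ N ∩ next
    N∩T⊆N∩next g∈ = let g∈N , g∈T = x∈p∩q⁻ N T g∈ in x∈p∩q⁺ (g∈N , keeps (x∈p∩q⁺ (N⊆F g∈N , g∈T)))
    bound′ : ∀ v → ¬ InA v → deg G next v ≤ deg G T₀ v + deg G (N ∩ next) v
    bound′ v v∉A = begin
      deg G next v                                    ≤⟨ deg-next v ⟩
      deg G T v + deg G ⁅ e ⁆ v                       ≤⟨ +-monoˡ-≤ _ (bound v v∉A) ⟩
      deg G T₀ v + deg G (N ∩ T) v + deg G ⁅ e ⁆ v    ≡⟨ +-assoc (deg G T₀ v) _ _ ⟩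
      deg G T₀ v + (deg G (N ∩ T) v + deg G ⁅ e ⁆ v)  ≤⟨ +-monoʳ-≤ (deg G T₀ v) N∩T+e≤N∩next ⟩
      deg G T₀ v + deg G (N ∩ next) v                 ∎
      where
      N∩T+e≤N∩next = deg+deg-⁅⁆≤ {v = v} (e∉T ∘ proj₂ ∘ x∈p∩q⁻ N T) N∩T⊆N∩next (x∈p∩q⁺ (e∈N , adds))

  phase₁ : ∃ λ H → Admissible H × N ⊆ H × (∀ v → ¬ InA v → deg G H v ≤ deg G T₀ v + deg G N v)
  phase₁ with descent (λ T → ∣ F ─ T ∣) Invariant₁ (N ⊆_) absorb-N T₀ (admissible₀ , λ v _ → m≤m+n _ _)
  ... | H , (adm , bound) , N⊆H =
    H , adm , N⊆H , λ v v∉A → ≤-trans (bound v v∉A) (+-monoʳ-≤ _ (deg-mono {v = v} (p∩q⊆p N H)))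

  K : Vtx G → ℕ
  K v = deg G F v ⊔ (deg G T₀ v + deg G N v)

  Invariant₂ : Factor G → Set
  Invariant₂ T = Admissible T × N ⊆ T × (∀ v → ¬ InA v → deg G T v ≤ K v)

  Saturated : Factor G → Set
  Saturated T = ∀ v → ¬ InA v → deg G F v ≤ deg G T v

  saturate : ∀ T → Invariant₂ T → Saturated T ⊎ ∃ λ T′ → Invariant₂ T′ × ∣ F ─ T′ ∣ < ∣ F ─ T ∣
  saturate T (adm , N⊆T , bound) with any? (λ v → ¬? (deg G F v ≤? m) ×-dec (deg G T v <? deg G F v))
  ... | no  none = inj₁ λ v v∉A → ≮⇒≥ λ deficient → none (v , v∉A , deficient)
  ... | yes (v , v∉A , deficient) with deg<deg⇒edge {v = v} deficient
  ...   | e , e∈F , e∉T , e∋v = inj₂ (next , (admissible , N⊆next , bound′) , shrinks)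
    where
    open Improvement (improve adm e∈F e∉T)
    N⊆next : N ⊆ next
    N⊆next g∈N = keeps (x∈p∩q⁺ (N⊆F g∈N , N⊆T g∈N))
    bound′ : ∀ w → ¬ InA w → deg G next w ≤ K w
    bound′ w w∉A with e ∈? incident G w
    ... | no  e∌w = begin
      deg G next w               ≤⟨ deg-next w ⟩
      deg G T w + deg G ⁅ e ⁆ w  ≡⟨ cong (deg G T w +_) (¬incident⇒deg-⁅⁆≡0 {v = w} e∌w) ⟩
      deg G T w + 0              ≡⟨ +-identityʳ _ ⟩
      deg G T w                  ≤⟨ bound w w∉A ⟩
      K w                        ∎
    ... | yes e∋w with outer-end-unique {v = v} {w} (∉Admissible⇒∈F─T₀ adm e∈F e∉T) e∋v e∋w v∉A w∉A
    ...   | refl = begin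
      deg G next v               ≤⟨ deg-next v ⟩
      deg G T v + deg G ⁅ e ⁆ v  ≤⟨ +-monoʳ-≤ (deg G T v) (deg-⁅⁆≤1 {e = e} {v}) ⟩
      deg G T v + 1              ≡⟨ +-comm _ 1 ⟩
      suc (deg G T v)            ≤⟨ deficient ⟩
      deg G F v                  ≤⟨ m≤m⊔n _ _ ⟩
      K v                        ∎

  phase₂ : ∃ λ H → Admissible H × N ⊆ H × (∀ v → ¬ InA v → deg G H v ≤ K v) × Saturated H
  phase₂ with phase₁
  ... | H₁ , adm₁ , N⊆H₁ , bound₁
    with descent (λ T → ∣ F ─ T ∣) Invariant₂ Saturated saturate H₁
                 (adm₁ , N⊆H₁ , λ v v∉A → ≤-trans (bound₁ v v∉A) (m≤n⊔m _ _))
  ... | H , (adm , N⊆H , bound) , saturated = H , adm , N⊆H , bound , saturated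

  F─M⊆ : Admissible H → N ⊆ H → F ─ M ⊆ H
  F─M⊆ adm N⊆H {g} g∈F─M with g ∈? T₀
  ... | yes g∈T₀ = keeps-F∩T₀ adm (x∈p∩q⁺ (g∈F , g∈T₀))
    where g∈F = p─q⊆p F M g∈F─M
  ... | no  g∉T₀ = N⊆H (x∈p∧x∉q⇒x∈p─q (x∈p∧x∉q⇒x∈p─q (p─q⊆p F M g∈F─M) g∉T₀) (x∈p─q⇒x∉q g∈F─M))

  deg-N+deg-M+deg-F∩T₀≤deg-F : ∀ v → deg G N v + (deg G M v + deg G (F ∩ T₀) v) ≤ deg G F v
  deg-N+deg-M+deg-F∩T₀≤deg-F v =
    ≤-trans (+-monoʳ-≤ (deg G N v) (deg-disjoint {v = v} M∩F∩T₀=∅ (p⊆p∪q _) (q⊆p∪q M (F ∩ T₀))))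
            (deg-disjoint {v = v} N∩[M∪F∩T₀]=∅ N⊆F M∪F∩T₀⊆F)
    where
    ∉T₀ : ∀ {g} → g ∈ F ─ T₀ → g ∉ T₀
    ∉T₀ = x∈p─q⇒x∉q
    M∩F∩T₀=∅ : Empty (M ∩ (F ∩ T₀))
    M∩F∩T₀=∅ (g , g∈) with x∈p∩q⁻ M _ g∈
    ... | g∈M , g∈F∩T₀ = ∉T₀ (M⊆F─T₀ g∈M) (proj₂ (x∈p∩q⁻ F T₀ g∈F∩T₀))
    N∩[M∪F∩T₀]=∅ : Empty (N ∩ (M ∪ (F ∩ T₀)))
    N∩[M∪F∩T₀]=∅ (g , g∈) with x∈p∩q⁻ N _ g∈
    ... | g∈N , g∈M∪F∩T₀ with x∈p∪q⁻ M (F ∩ T₀) g∈M∪F∩T₀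
    ...   | inj₁ g∈M    = x∈p─q⇒x∉q g∈N g∈M
    ...   | inj₂ g∈F∩T₀ = ∉T₀ (p─q⊆p _ M g∈N) (proj₂ (x∈p∩q⁻ F T₀ g∈F∩T₀))
    M∪F∩T₀⊆F : M ∪ (F ∩ T₀) ⊆ F
    M∪F∩T₀⊆F g∈ = [ p─q⊆p F T₀ ∘ M⊆F─T₀ , proj₁ ∘ x∈p∩q⁻ F T₀ ]′ (x∈p∪q⁻ M (F ∩ T₀) g∈)

  degree-bounds : (∀ v → ¬ InA v → m ≤ deg G M v + deg G (F ∩ T₀) v) →
                  Admissible H → (∀ v → ¬ InA v → deg G H v ≤ K v) →
                  Saturated H → ∀ v → deg G F v ≤ deg G H v × deg G H v ≤ deg G T₀ v + (0 ⊔ (deg G F v ∸ m))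
  degree-bounds {H} covered adm bound saturated v with deg G F v ≤? m
  ... | yes v∈A = deg-F≤deg-H , ≤-trans (deg-A adm v v∈A) (m≤m+n _ _)
    where
    deg-F≤deg-H : deg G F v ≤ deg G H v
    deg-F≤deg-H with 0 <? deg G F v
    ... | no  deg-F≡0 = ≤-trans (≮⇒≥ deg-F≡0) z≤n
    ... | yes 0<deg-F = ≤-trans v∈A
                          (treeConnected⇒m≤deg {v = v} (treeConnected adm) (proj₂ (0<deg⇒incident {X = F} {v} 0<deg-F)))
  ... | no  v∉A = saturated v v∉A , ≤-trans (bound v v∉A) (⊔-lub deg-F≤ deg-T₀+deg-N≤)
    where
    m≤deg-T₀ : m ≤ deg G T₀ v
    m≤deg-T₀ = treeConnected⇒m≤deg {v = v} tc₀ (proj₂ (0<deg⇒incident {X = F} {v} (≤-trans (s≤s z≤n) (≰⇒> v∉A))))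
    deg-F≤ : deg G F v ≤ deg G T₀ v + (deg G F v ∸ m)
    deg-F≤ = ≤-trans (m≤n+m∸n (deg G F v) m) (+-monoˡ-≤ _ m≤deg-T₀)
    deg-T₀+deg-N≤ : deg G T₀ v + deg G N v ≤ deg G T₀ v + (deg G F v ∸ m)
    deg-T₀+deg-N≤ = +-monoʳ-≤ (deg G T₀ v) (m+n≤o⇒m≤o∸n (deg G N v)
      (≤-trans (+-monoʳ-≤ (deg G N v) (covered v v∉A)) (deg-N+deg-M+deg-F∩T₀≤deg-F v)))

theorem3p2 : (G : Graph) (m : ℕ) → 1 ≤ m → (F T : Factor G) → TreeConnected G m T →
    (∀ e → e ∈ (F ─ T) →
    (deg G F (proj₁ (ends G e)) ≤ m × ¬ (deg G F (proj₂ (ends G e)) ≤ m))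
    ⊎ (¬ (deg G F (proj₁ (ends G e)) ≤ m) × deg G F (proj₂ (ends G e)) ≤ m)) →
    (M : Factor G) → M ⊆ (F ─ T) →
    (∀ v → ¬ (deg G F v ≤ m) → m ≤ deg G M v + deg G (F ∩ T) v) →
    ∃ λ (H : Factor G) → TreeConnected G m H × (F ─ M) ⊆ H ×
    (∀ v → deg G F v ≤ deg G H v × deg G H v ≤ deg G T v + (0 ⊔ (deg G F v ∸ m)))
theorem3p2 G m _ F T tc bipartite M M⊆F─T covered =
  let open Construction G m F T M tc bipartite M⊆F─T
      H , admissible , N⊆H , bound , saturated = phase₂
  in H , Admissible.treeConnected admissible , F─M⊆ admissible N⊆H ,
     degree-bounds covered admissible bound saturated
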